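{- Let $(G,\mathbf{w})$ be a connected weighted graph with vertices $v_1,\dots,v_n$ and let $w_{ij}=d_\mathbf{w}(v_i,v_j)$. Then $\beta(G,\mathbf{w}) \geq \frac{\sum_{1\le i<j\le n} w_{ij}}{\lfloor n^2/4\rfloor}$.
   Context: A weighted graph $(G,\mathbf{w})$ is a finite simple graph with positive integer edge weights that is weight-minimal: every edge is a shortest path between its endpoints. $d_\mathbf{w}(u,v)$ is the minimum total weight of a $(u,v)$-path. For a positive integer $\lambda$, $c_\lambda(G,\mathbf{w})$ is the minimum $m$ such that there is $f:V(G)\to\{0,1\}^m$ with $\lambda\, d_\mathbf{w}(u,v)\le d_H(f(u),f(v))$ for all $u,v$ ($d_H$ the Hamming distance). $\beta(G,\mathbf{w}):=\lim_{\lambda\to\infty} c_\lambda(G,\mathbf{w})/\lambda$ (this limit exists by subadditivity). -}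

module Defs where

open import Data.Nat using (ℕ; zero; suc; _+_; _*_; _≤_; _<_; _/_)
open import Data.Fin using (Fin; toℕ)
open import Data.Fin.Properties using () renaming (_≟_ to _≟F_)
open import Data.Bool using (Bool; true; false; if_then_else_)
open import Data.Vec using (Vec; []; _∷_)
open import Data.List using (List; []; _∷_; map; allFin)
open import Data.Nat.ListAction using (sum)
open import Data.List.Relation.Unary.Unique.Propositional using (Unique)
open import Data.Product using (Σ; _×_; _,_; ∃)
open import Relation.Nullary using (¬_; does)
open import Data.Nat using (_<?_)
open import Relation.Binary.PropositionalEquality using (_≡_)

record WGraph (n : ℕ) : Set₁ where
  field
    Edge   : Fin n → Fin n → Set
    sym    : ∀ {u v} → Edge u v → Edge v u
    irrefl : ∀ {u} → ¬ Edge u u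
    w      : Fin n → Fin n → ℕ
    w-sym  : ∀ {u v} → Edge u v → w u v ≡ w v u
    w-pos  : ∀ {u v} → Edge u v → 1 ≤ w u v

module _ {n : ℕ} (G : WGraph n) where
  open WGraph G

  data Walk : Fin n → Fin n → Set where
    [] : ∀ {u} → Walk u u
    _∷_ : ∀ {u v x} → Edge u v → Walk v x → Walk u x

  weight : ∀ {u v} → Walk u v → ℕ
  weight [] = 0
  weight (_∷_ {u} {v} e p) = w u v + weight p

  verts : ∀ {u v} → Walk u v → List (Fin n)
  verts {u} [] = u ∷ []
  verts {u} (e ∷ p) = u ∷ verts p

  IsPath : ∀ {u v} → Walk u v → Set
  IsPath p = Unique (verts p)

  Connected : Set
  Connected = ∀ u v → Σ (Walk u v) IsPath

  WeightMinimal : Set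
  WeightMinimal = ∀ {u v} → Edge u v → (p : Walk u v) → IsPath p → w u v ≤ weight p

  IsDist : Fin n → Fin n → ℕ → Set
  IsDist u v d = (Σ (Walk u v) λ p → IsPath p × weight p ≡ d)
               × ((p : Walk u v) → IsPath p → d ≤ weight p)

hamming : ∀ {m} → Vec Bool m → Vec Bool m → ℕ
hamming [] [] = 0
hamming (a ∷ as) (b ∷ bs) = (if does (Data.Bool._≟_ a b) then 0 else 1) + hamming as bs

Embeds : ∀ {n} → (Fin n → Fin n → ℕ) → ℕ → ℕ → Set
Embeds {n} d lam m = Σ (Fin n → Vec Bool m) λ f → ∀ u v → lam * d u v ≤ hamming (f u) (f v)

IsC : ∀ {n} → (Fin n → Fin n → ℕ) → ℕ → ℕ → Set
IsC d lam m = Embeds d lam m × (∀ m' → m' < m → ¬ Embeds d lam m')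

sumPairs : ∀ {n} → (Fin n → Fin n → ℕ) → ℕ
sumPairs {n} d = sum (map (λ i → sum (map (λ j → if does (toℕ i <? toℕ j) then d i j else 0) (allFin n))) (allFin n))

quarterSq : ℕ → ℕ
quarterSq n = (n * n) / 4

-- "lim_{λ→∞} c_λ/λ ≥ p/q" for the sequence c given as a relation C λ m (m = c_λ),
-- unfolded without reals: for every ε = 1/(k+1) eventually c_λ/λ ≥ p/q - ε,
-- i.e. c_λ·q·(k+1) + q·λ ≥ p·λ·(k+1).  (Equivalent to lim ≥ p/q since the limit exists.)
LimRatioGE : (ℕ → ℕ → Set) → ℕ → ℕ → Set
LimRatioGE C p q = ∀ k → ∃ λ Λ → ∀ lam m → Λ ≤ lam → 1 ≤ lam → C lam m →
                   p * lam * suc k ≤ m * q * suc k + q * lam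

{-# OPTIONS --safe #-}
-- Each coordinate of an embedding f : V → {0,1}^m cuts V into the t vertices where it is 1
-- and the n − t where it is 0, and contributes to the Hamming distance exactly on the
-- t (n − t) ≤ ⌊n²/4⌋ pairs crossing the cut. Summing over pairs and coordinates,
-- λ Σ_{i<j} w_ij ≤ Σ_{i<j} d_H(f v_i, f v_j) ≤ m ⌊n²/4⌋ for every embedding, so already
-- c_λ / λ ≥ Σ w_ij / ⌊n²/4⌋ for each λ.
module Submission where

open import Defs
open import Data.Nat using (ℕ; zero; suc; _+_; _*_; _≤_; _<?_)
open import Data.Nat.Properties
open import Data.Nat.DivMod using (m*n/n≡m; /-monoˡ-≤)
open import Data.Nat.ListAction using () renaming (sum to listSum)
open import Data.Nat.Tactic.RingSolver using (solve-∀)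
open import Data.Fin using (Fin; zero; suc; toℕ)
open import Data.Bool using (Bool; true; false; if_then_else_)
import Data.Bool
open import Data.Vec using (Vec; []; _∷_; head; tail)
open import Data.Vec.Functional using (Vector)
open import Data.List using (map; allFin; tabulate)
open import Data.List.Properties using (map-tabulate)
open import Data.Product using (_,_)
open import Data.Sum using ([_,_]′)
open import Function using (_∘_; id)
open import Relation.Nullary using (does)
open import Relation.Binary.PropositionalEquality
open import Algebra.Properties.CommutativeSemigroup +-commutativeSemigroup
  using () renaming (interchange to +-interchange)
open import Algebra.Properties.Semiring.Sum +-*-semiring
  using (sum; sum-syntax; sum-cong-≗; sum-replicate-zero; *-distribˡ-sum)

∑-+ : ∀ {n} (x y : Vector ℕ n) → ∑[ i < n ] (x i + y i) ≡ sum x + sum y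
∑-+ {zero} x y = refl
∑-+ {suc n} x y = begin
  (x zero + y zero) + ∑[ i < n ] (x (suc i) + y (suc i))
    ≡⟨ cong (x zero + y zero +_) (∑-+ (x ∘ suc) (y ∘ suc)) ⟩
  (x zero + y zero) + (sum (x ∘ suc) + sum (y ∘ suc))
    ≡⟨ +-interchange (x zero) (y zero) _ _ ⟩
  (x zero + sum (x ∘ suc)) + (y zero + sum (y ∘ suc)) ∎
  where open ≡-Reasoning

∑-mono-≤ : ∀ {n} {x y : Vector ℕ n} → (∀ i → x i ≤ y i) → sum x ≤ sum y
∑-mono-≤ {zero} x≤y = ≤-refl
∑-mono-≤ {suc n} x≤y = +-mono-≤ (x≤y zero) (∑-mono-≤ (x≤y ∘ suc))

listSum-tabulate : ∀ {n} (x : Vector ℕ n) → listSum (tabulate x) ≡ sum x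
listSum-tabulate {zero} x = refl
listSum-tabulate {suc n} x = cong (x zero +_) (listSum-tabulate (x ∘ suc))

listSum-map-allFin : ∀ {n} (x : Vector ℕ n) → listSum (map x (allFin n)) ≡ sum x
listSum-map-allFin x = trans (cong listSum (map-tabulate id x)) (listSum-tabulate x)

strictUpper : ∀ {n} → (Fin n → Fin n → ℕ) → Fin n → Fin n → ℕ
strictUpper d i j = if does (toℕ i <? toℕ j) then d i j else 0

pairSum : ∀ {n} → (Fin n → Fin n → ℕ) → ℕ
pairSum {n} d = ∑[ i < n ] ∑[ j < n ] strictUpper d i j

sumPairs≡pairSum : ∀ {n} (d : Fin n → Fin n → ℕ) → sumPairs d ≡ pairSum d
sumPairs≡pairSum {n} d = trans
  (listSum-map-allFin (λ i → listSum (map (strictUpper d i) (allFin n))))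
  (sum-cong-≗ (λ i → listSum-map-allFin (strictUpper d i)))

pairSum-cong : ∀ {n} {d e : Fin n → Fin n → ℕ} →
               (∀ i j → d i j ≡ e i j) → pairSum d ≡ pairSum e
pairSum-cong d≡e = sum-cong-≗ (λ i → sum-cong-≗ (λ j → cong (if _ then_else 0) (d≡e i j)))

pairSum-mono-≤ : ∀ {n} {d e : Fin n → Fin n → ℕ} →
                 (∀ i j → d i j ≤ e i j) → pairSum d ≤ pairSum e
pairSum-mono-≤ d≤e = ∑-mono-≤ (λ i → ∑-mono-≤ (λ j → restrict (does (toℕ i <? toℕ j)) (d≤e i j)))
  where
  restrict : ∀ b {x y} → x ≤ y → (if b then x else 0) ≤ (if b then y else 0)
  restrict true x≤y = x≤y
  restrict false _ = ≤-refl

pairSum-+ : ∀ {n} (d e : Fin n → Fin n → ℕ) →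
            pairSum (λ i j → d i j + e i j) ≡ pairSum d + pairSum e
pairSum-+ {n} d e = begin
  pairSum (λ i j → d i j + e i j)
    ≡⟨ sum-cong-≗ (λ i → sum-cong-≗ (λ j → restrict (does (toℕ i <? toℕ j)) (d i j) (e i j))) ⟩
  ∑[ i < n ] ∑[ j < n ] (strictUpper d i j + strictUpper e i j)
    ≡⟨ sum-cong-≗ (λ i → ∑-+ (strictUpper d i) (strictUpper e i)) ⟩
  ∑[ i < n ] (∑[ j < n ] strictUpper d i j + ∑[ j < n ] strictUpper e i j)
    ≡⟨ ∑-+ (λ i → ∑[ j < n ] strictUpper d i j) (λ i → ∑[ j < n ] strictUpper e i j) ⟩
  pairSum d + pairSum e ∎
  where
  open ≡-Reasoning
  restrict : ∀ b x y → (if b then x + y else 0) ≡ (if b then x else 0) + (if b then y else 0)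
  restrict true _ _ = refl
  restrict false _ _ = refl

*-distribˡ-pairSum : ∀ {n} c (d : Fin n → Fin n → ℕ) →
                     c * pairSum d ≡ pairSum (λ i j → c * d i j)
*-distribˡ-pairSum {n} c d = begin
  c * pairSum d
    ≡⟨ *-distribˡ-sum c (λ i → ∑[ j < n ] strictUpper d i j) ⟩
  ∑[ i < n ] (c * ∑[ j < n ] strictUpper d i j)
    ≡⟨ sum-cong-≗ (λ i → *-distribˡ-sum c (strictUpper d i)) ⟩
  ∑[ i < n ] ∑[ j < n ] (c * strictUpper d i j)
    ≡⟨ sum-cong-≗ (λ i → sum-cong-≗ (λ j → restrict (does (toℕ i <? toℕ j)) (d i j))) ⟩
  pairSum (λ i j → c * d i j) ∎
  where
  open ≡-Reasoning
  restrict : ∀ b x → c * (if b then x else 0) ≡ (if b then c * x else 0)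
  restrict true _ = refl
  restrict false _ = *-zeroʳ c

pairSum-zero : ∀ n → pairSum {n} (λ _ _ → 0) ≡ 0
pairSum-zero zero = refl
pairSum-zero (suc n) = cong₂ _+_ (sum-replicate-zero n) (pairSum-zero n)

m*n*4≤[m+n]*[m+n] : ∀ m n → m * n * 4 ≤ (m + n) * (m + n)
m*n*4≤[m+n]*[m+n] m n = [ ordered , swapped ]′ (≤-total m n)
  where
  square-expand : ∀ a k → (a + (a + k)) * (a + (a + k)) ≡ a * (a + k) * 4 + k * k
  square-expand = solve-∀

  ordered : ∀ {a b} → a ≤ b → a * b * 4 ≤ (a + b) * (a + b)
  ordered {a} a≤b with k , refl ← m≤n⇒∃[o]m+o≡n a≤b =
    subst (a * (a + k) * 4 ≤_) (sym (square-expand a k)) (m≤m+n _ (k * k))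

  swapped : n ≤ m → m * n * 4 ≤ (m + n) * (m + n)
  swapped n≤m = subst₂ _≤_ (cong (_* 4) (*-comm n m)) (cong (λ s → s * s) (+-comm n m)) (ordered n≤m)

m*n≤quarterSq[m+n] : ∀ m n → m * n ≤ quarterSq (m + n)
m*n≤quarterSq[m+n] m n = subst (_≤ quarterSq (m + n)) (m*n/n≡m (m * n) 4)
  (/-monoˡ-≤ 4 (m*n*4≤[m+n]*[m+n] m n))

mismatch : Bool → Bool → ℕ
mismatch a b = if does (a Data.Bool.≟ b) then 0 else 1

ones : ∀ {n} → Vector Bool n → ℕ
ones g = sum (λ j → if g j then 1 else 0)

zeros : ∀ {n} → Vector Bool n → ℕ
zeros g = sum (λ j → if g j then 0 else 1)

ones+zeros : ∀ {n} (g : Vector Bool n) → ones g + zeros g ≡ n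
ones+zeros {zero} g = refl
ones+zeros {suc n} g with g zero
... | true = cong suc (ones+zeros (g ∘ suc))
... | false = trans (+-suc (ones (g ∘ suc)) (zeros (g ∘ suc))) (cong suc (ones+zeros (g ∘ suc)))

∑-mismatch : ∀ {n} b (g : Vector Bool n) →
             ∑[ j < n ] mismatch b (g j) ≡ (if b then zeros g else ones g)
∑-mismatch {zero} true g = refl
∑-mismatch {zero} false g = refl
∑-mismatch {suc n} b g with b | g zero | ∑-mismatch b (g ∘ suc)
... | true | true | ih = ih
... | true | false | ih = cong suc ih
... | false | true | ih = cong suc ih
... | false | false | ih = ih

-- pairSum {suc n} d reduces to the row of vertex 0 plus pairSum of d on the remaining vertices.
pairSum-mismatch : ∀ {n} (g : Vector Bool n) →
                   pairSum (λ i j → mismatch (g i) (g j)) ≡ ones g * zeros g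
pairSum-mismatch {zero} g = refl
pairSum-mismatch {suc n} g with g zero | ∑-mismatch (g zero) (g ∘ suc) | pairSum-mismatch (g ∘ suc)
... | true | row | rest = cong₂ _+_ row rest
... | false | row | rest = trans (cong₂ _+_ row rest) (sym (*-suc (ones (g ∘ suc)) (zeros (g ∘ suc))))

pairSum-mismatch≤quarterSq : ∀ {n} (g : Vector Bool n) →
                             pairSum (λ i j → mismatch (g i) (g j)) ≤ quarterSq n
pairSum-mismatch≤quarterSq {n} g = begin
  pairSum (λ i j → mismatch (g i) (g j)) ≡⟨ pairSum-mismatch g ⟩
  ones g * zeros g                       ≤⟨ m*n≤quarterSq[m+n] (ones g) (zeros g) ⟩
  quarterSq (ones g + zeros g)           ≡⟨ cong quarterSq (ones+zeros g) ⟩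
  quarterSq n                            ∎
  where open ≤-Reasoning

hamming-∷ : ∀ {m} (a b : Vec Bool (suc m)) →
            hamming a b ≡ mismatch (head a) (head b) + hamming (tail a) (tail b)
hamming-∷ (_ ∷ _) (_ ∷ _) = refl

hamming-[] : (a b : Vec Bool 0) → hamming a b ≡ 0
hamming-[] [] [] = refl

pairSum-hamming≤ : ∀ {n} m (f : Fin n → Vec Bool m) →
                   pairSum (λ i j → hamming (f i) (f j)) ≤ m * quarterSq n
pairSum-hamming≤ {n} zero f =
  ≤-reflexive (trans (pairSum-cong (λ i j → hamming-[] (f i) (f j))) (pairSum-zero n))
pairSum-hamming≤ {n} (suc m) f = begin
  pairSum (λ i j → hamming (f i) (f j))      ≡⟨ pairSum-cong (λ i j → hamming-∷ (f i) (f j)) ⟩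
  pairSum (λ i j → first i j + rest i j)     ≡⟨ pairSum-+ first rest ⟩
  pairSum first + pairSum rest               ≤⟨ +-mono-≤ (pairSum-mismatch≤quarterSq (head ∘ f))
                                                         (pairSum-hamming≤ m (tail ∘ f)) ⟩
  quarterSq n + m * quarterSq n              ∎
  where
  open ≤-Reasoning
  first rest : Fin n → Fin n → ℕ
  first i j = mismatch (head (f i)) (head (f j))
  rest i j = hamming (tail (f i)) (tail (f j))

Embeds⇒*sumPairs≤*quarterSq : ∀ {n} (d : Fin n → Fin n → ℕ) lam {m} →
                               Embeds d lam m → lam * sumPairs d ≤ m * quarterSq n
Embeds⇒*sumPairs≤*quarterSq {n} d lam {m} (f , embeds) = begin
  lam * sumPairs d                      ≡⟨ cong (lam *_) (sumPairs≡pairSum d) ⟩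
  lam * pairSum d                       ≡⟨ *-distribˡ-pairSum lam d ⟩
  pairSum (λ i j → lam * d i j)         ≤⟨ pairSum-mono-≤ embeds ⟩
  pairSum (λ i j → hamming (f i) (f j)) ≤⟨ pairSum-hamming≤ m f ⟩
  m * quarterSq n                       ∎
  where open ≤-Reasoning

theorem5 : ∀ {n} (G : WGraph n) → Connected G → WeightMinimal G →
           (d : Fin n → Fin n → ℕ) → (∀ u v → IsDist G u v (d u v)) →
           LimRatioGE (IsC d) (sumPairs d) (quarterSq n)
theorem5 {n} _ _ _ d _ k = 0 , λ lam m _ _ (embedding , _) → begin
  sumPairs d * lam * suc k                    ≡⟨ cong (_* suc k) (*-comm (sumPairs d) lam) ⟩
  lam * sumPairs d * suc k                    ≤⟨ *-monoˡ-≤ (suc k)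
                                                   (Embeds⇒*sumPairs≤*quarterSq d lam embedding) ⟩
  m * quarterSq n * suc k                     ≤⟨ m≤m+n _ (quarterSq n * lam) ⟩
  m * quarterSq n * suc k + quarterSq n * lam ∎
  where open ≤-Reasoning
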